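{- Let $A$ be an apex graph, let $z\in V(A)$ be such that $H:=A-z$ is planar, and let $d:=\deg_A(z)$. Let $k,\ell\geq 1$ be integers such that $H$ is a minor of the $k\times\ell$ grid. Let $r\geq 1$ be an integer and let $G$ be an $A$-minor-free graph with radius $r$. Then $G$ has no $(2kn+1)\times(2\ell n+1)$ grid minor, where $n:=4(r-1)d+1$.
   Context: All graphs are finite, simple and undirected. A graph $A$ is apex if $A-z$ is planar for some vertex $z\in V(A)$. A graph $H$ is a minor of $G$ if a graph isomorphic to $H$ can be obtained from a subgraph of $G$ by contracting edges; $G$ is $A$-minor-free if $A$ is not a minor of $G$. The $n\times m$ grid is the graph with vertex set $\{1,\dots,n\}\times\{1,\dots,m\}$ where $(x_1,y_1)$ and $(x_2,y_2)$ are adjacent iff $|x_1-x_2|+|y_1-y_2|=1$. The radius of a connected graph $G$ is $\min_{\alpha\in V(G)}\max_{v\in V(G)}\mathrm{dist}_G(\alpha,v)$. -}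

module Defs where

open import Data.Nat using (ℕ; zero; suc; _+_; _≤_; _≡ᵇ_; ∣_-_∣)
open import Data.Fin using (Fin; toℕ; punchIn; remQuot)
open import Data.Bool using (Bool; true; false; if_then_else_)
open import Data.List using (List; map; allFin)
open import Data.Nat.ListAction using (sum)
open import Data.Product using (_×_; _,_; ∃; ∃₂; proj₁; proj₂)
open import Relation.Binary.PropositionalEquality using (_≡_)

Graph : ℕ → Set
Graph n = Fin n → Fin n → Bool

Simple : ∀ {n} → Graph n → Set
Simple {n} G = (∀ (u v : Fin n) → G u v ≡ G v u) × (∀ (v : Fin n) → G v v ≡ false)

delete : ∀ {n} → Graph (suc n) → Fin (suc n) → Graph n
delete G z i j = G (punchIn z i) (punchIn z j)

degree : ∀ {n} → Graph n → Fin n → ℕ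
degree {n} G z = sum (map (λ v → if G z v then 1 else 0) (allFin n))

grid : (n m : ℕ) → Graph (Data.Nat._*_ n m)
grid n m i j =
  (∣ toℕ (proj₁ (remQuot {n} m i)) - toℕ (proj₁ (remQuot {n} m j)) ∣
    + ∣ toℕ (proj₂ (remQuot {n} m i)) - toℕ (proj₂ (remQuot {n} m j)) ∣) ≡ᵇ 1

-- ConnIn G P u v : there is a walk from u to v in G all of whose vertices
-- after u lie in P (used with u ∈ P, so the whole walk stays in P).
data ConnIn {n} (G : Graph n) (P : Fin n → Set) : Fin n → Fin n → Set where
  here : ∀ {u} → ConnIn G P u u
  step : ∀ {u w v} → G u w ≡ true → P w → ConnIn G P w v → ConnIn G P u v

record IsMinor {h n} (H : Graph h) (G : Graph n) : Set₁ where
  field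
    branch    : Fin h → Fin n → Set
    nonempty  : ∀ x → ∃ λ v → branch x v
    connected : ∀ x u v → branch x u → branch x v → ConnIn G (branch x) u v
    disjoint  : ∀ x y v → branch x v → branch y v → x ≡ y
    edges     : ∀ x y → H x y ≡ true →
                ∃₂ λ u v → branch x u × branch y v × G u v ≡ true

data Walk {n} (G : Graph n) : Fin n → Fin n → ℕ → Set where
  nil  : ∀ {u} → Walk G u u 0
  cons : ∀ {u w v m} → G u w ≡ true → Walk G w v m → Walk G u v (suc m)

-- G is connected and has radius exactly r:
-- some centre α has dist(α,v) ≤ r for all v (this also gives connectivity),
-- and every α has some v with dist(α,v) ≥ r.
Radius : ∀ {n} → Graph n → ℕ → Set
Radius {n} G r =
  (∃ λ (α : Fin n) → ∀ (v : Fin n) → ∃ λ m → m ≤ r × Walk G α v m)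
  × (∀ (α : Fin n) → ∃ λ (v : Fin n) → ∀ m → Walk G α v m → r ≤ m)

-- Fix a centre α of G and a model of the K × L grid in G, and cut the grid into k × ℓ blocks of
-- width w = 2n. For every neighbour j of z, a walk of length ≤ r runs from α to the branch set of
-- the corner of a block where the model of A - z in the k × ℓ grid puts j. Together with α, the
-- inner vertices of these walks form a set Z₀ of at most 1 + (r - 1) d < w vertices, so the grid
-- points X whose branch sets meet Z₀ miss some row and some column of every block. That row and
-- column, with a spur along the first column of the block from the row towards the corner, give a
-- model of the k × ℓ grid, hence of A - z, avoiding Z₀. The vertices of Z₀ and the branch sets of
-- X form a connected set touching the branch set of every neighbour of z: through the last edge
-- of its walk if the spur reaches the corner, and where the spur was stopped otherwise. Taking it
-- as the branch set of z gives A as a minor of G.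
-- Whether a vertex lies in some branch set is not decidable; the decision is only assumed under a
-- double negation, which is harmless because the conclusion is a negation.

module Submission where

open import Defs
open import Level using (0ℓ)
open import Function using (_∘_)
open import Data.Nat using (ℕ; zero; suc; _+_; _*_; _∸_; _<_; _≤_; _≡ᵇ_; ∣_-_∣; s≤s; z≤n)
open import Data.Nat.Properties
open import Data.Nat.ListAction using (sum)
open import Data.Nat.Tactic.RingSolver using (solve-∀)
open import Data.Fin as Fin using (Fin; zero; suc; toℕ; fromℕ<; combine; remQuot; punchIn; punchOut)
open import Data.Fin.Properties
  using ( punchIn-punchOut; combine-remQuot; remQuot-combine; toℕ-fromℕ<; toℕ-injective; toℕ<n
        ; pigeonhole; ¬∀⟶∃¬)
open import Data.Bool using (true; false; if_then_else_; T)
open import Data.Unit using (tt)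
open import Data.Empty using (⊥-elim)
open import Data.Product using (_,_; _×_; proj₁; proj₂; ∃; ∃₂)
open import Data.Sum using (_⊎_; inj₁; inj₂)
open import Data.List using (List; []; _∷_; _++_; length; map; concat; tabulate; lookup)
open import Data.List.Properties using (length-++; length-map; map-tabulate)
open import Data.List.Membership.Propositional using (_∈_; _∉_)
open import Data.List.Membership.Propositional.Properties
  using (∈-map⁺; ∈-concat⁺′; ∈-concat⁻′; ∈-tabulate⁺; ∈-tabulate⁻)
open import Data.List.Relation.Unary.Any using (here; there; index)
open import Data.List.Relation.Unary.Any.Properties using (lookup-index)
open import Relation.Nullary using (Dec; yes; no; ¬_; contradiction)
open import Relation.Nullary.Decidable using (¬¬-excluded-middle)
open import Relation.Unary using (Pred; _⊆_)
open import Relation.Binary.Definitions using (tri<; tri≈; tri>)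
open import Relation.Binary.PropositionalEquality using (_≡_; refl; sym; trans; cong; cong₂; subst)

Symmetric : ∀ {n} → Graph n → Set
Symmetric {n} G = ∀ (u v : Fin n) → G u v ≡ G v u

module _ {n} {G : Graph n} where

  ConnIn-mono : ∀ {P Q : Fin n → Set} {u v} → P ⊆ Q → ConnIn G P u v → ConnIn G Q u v
  ConnIn-mono P⊆Q here          = here
  ConnIn-mono P⊆Q (step e pw c) = step e (P⊆Q pw) (ConnIn-mono P⊆Q c)

  ConnIn-trans : ∀ {P : Fin n → Set} {u v w} → ConnIn G P u v → ConnIn G P v w → ConnIn G P u w
  ConnIn-trans here          d = d
  ConnIn-trans (step e pw c) d = step e pw (ConnIn-trans c d)

  ConnIn-sym : ∀ {P : Fin n → Set} {u v} → Symmetric G → P u → ConnIn G P u v → ConnIn G P v u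
  ConnIn-sym sym-G pu here = here
  ConnIn-sym {u = u} sym-G pu (step {w = w} e pw c) =
    ConnIn-trans (ConnIn-sym sym-G pw c) (step (trans (sym-G w u) e) pu here)

module _ {n} {G : Graph n} where

  interior : ∀ {u v m} → Walk G u v m → List (Fin n)
  interior nil                          = []
  interior (cons _ nil)                 = []
  interior (cons {w = w} _ p@(cons _ _)) = w ∷ interior p

  length-interior : ∀ {u v m} (p : Walk G u v m) → length (interior p) ≡ m ∸ 1
  length-interior nil                   = refl
  length-interior (cons _ nil)          = refl
  length-interior (cons _ p@(cons _ _)) = cong suc (length-interior p)

  ConnIn-interior : ∀ {u v m} (p : Walk G u v m) {x} → x ∈ interior p → ConnIn G (_∈ interior p) u x
  ConnIn-interior (cons e (cons _ _)) (here refl) = step e (here refl) here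
  ConnIn-interior (cons e p@(cons _ _)) (there x∈) =
    step e (here refl) (ConnIn-mono there (ConnIn-interior p x∈))

  last-edge : ∀ {u v m} (p : Walk G u v (suc m)) → ∃ λ s → (s ≡ u ⊎ s ∈ interior p) × G s v ≡ true
  last-edge (cons e nil) = _ , inj₁ refl , e
  last-edge (cons e p@(cons _ _)) with last-edge p
  ... | s , inj₁ refl , g = s , inj₂ (here refl) , g
  ... | s , inj₂ s∈   , g = s , inj₂ (there s∈) , g

module _ {m n} {K : Graph m} {G : Graph n} (M : IsMinor K G) where
  open IsMinor M

  BranchUnion : Pred (Fin m) 0ℓ → Pred (Fin n) 0ℓ
  BranchUnion S v = ∃ λ p → S p × branch p v

  ConnIn-lift : ∀ {S : Fin m → Set} {p q u u'} → ConnIn K S p q → S p →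
                branch p u → branch q u' → ConnIn G (BranchUnion S) u u'
  ConnIn-lift {p = p} here sp bu bu' =
    ConnIn-mono (λ bv → p , sp , bv) (connected p _ _ bu bu')
  ConnIn-lift {p = p} (step {w = q} e sq c) sp bu bu' with edges p q e
  ... | s , t , bs , bt , g =
    ConnIn-trans (ConnIn-mono (λ bv → p , sp , bv) (connected p _ _ bu bs))
                 (step g (q , sq , bt) (ConnIn-lift c sq bt bu'))

IsMinor-trans : ∀ {h m n} {H : Graph h} {K : Graph m} {G : Graph n} →
                IsMinor H K → IsMinor K G → IsMinor H G
IsMinor-trans {H = H} {K} {G} C M = record
  { branch    = λ x → BranchUnion M (C.branch x)
  ; nonempty  = nonempty
  ; connected = λ x u v → connected
  ; disjoint  = disjoint
  ; edges     = edges
  }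
  where
  module C = IsMinor C
  module M = IsMinor M

  nonempty : ∀ x → ∃ (BranchUnion M (C.branch x))
  nonempty x with C.nonempty x
  ... | p , cp = proj₁ (M.nonempty p) , p , cp , proj₂ (M.nonempty p)

  connected : ∀ {x u v} → BranchUnion M (C.branch x) u → BranchUnion M (C.branch x) v →
              ConnIn G (BranchUnion M (C.branch x)) u v
  connected {x} (p , cp , bu) (q , cq , bv) = ConnIn-lift M (C.connected x p q cp cq) cp bu bv

  disjoint : ∀ x y v → BranchUnion M (C.branch x) v → BranchUnion M (C.branch y) v → x ≡ y
  disjoint x y v (p , cp , bp) (q , cq , bq) with M.disjoint p q v bp bq
  ... | refl = C.disjoint x y p cp cq

  edges : ∀ x y → H x y ≡ true →
          ∃₂ λ u v → BranchUnion M (C.branch x) u × BranchUnion M (C.branch y) v × G u v ≡ true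
  edges x y e with C.edges x y e
  ... | p , q , cp , cq , kpq with M.edges p q kpq
  ... | u , v , bu , bv , g = u , v , (p , cp , bu) , (q , cq , bv) , g

module Owners {m n} {F : Graph m} {G : Graph n} (M : IsMinor F G)
              (owned? : ∀ v → Dec (∃ λ p → IsMinor.branch M p v)) where
  open IsMinor M

  owners : List (Fin n) → List (Fin m)
  owners []       = []
  owners (v ∷ vs) with owned? v
  ... | yes (p , _) = p ∷ owners vs
  ... | no _        = owners vs

  length-owners : ∀ vs → length (owners vs) ≤ length vs
  length-owners []       = z≤n
  length-owners (v ∷ vs) with owned? v
  ... | yes _ = s≤s (length-owners vs)
  ... | no _  = m≤n⇒m≤1+n (length-owners vs)

  ∈-owners⁻ : ∀ {p} vs → p ∈ owners vs → ∃ λ v → v ∈ vs × branch p v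
  ∈-owners⁻ (v ∷ vs) p∈ with owned? v | p∈
  ... | yes (_ , pv) | here refl = v , here refl , pv
  ... | yes _        | there p∈′ = let u , u∈ , pu = ∈-owners⁻ vs p∈′ in u , there u∈ , pu
  ... | no _         | p∈′       = let u , u∈ , pu = ∈-owners⁻ vs p∈′ in u , there u∈ , pu

  ∈-owners⁺ : ∀ {p v} vs → v ∈ vs → branch p v → p ∈ owners vs
  ∈-owners⁺ {p} (u ∷ vs) v∈ pv with owned? u | v∈
  ... | yes (q , qu) | here refl = here (disjoint p q _ pv qu)
  ... | yes _        | there v∈′ = there (∈-owners⁺ vs v∈′ pv)
  ... | no ¬owned    | here refl = contradiction (p , pv) ¬owned
  ... | no _         | there v∈′ = ∈-owners⁺ vs v∈′ pv

data PunchView {a} (z : Fin (suc a)) : Fin (suc a) → Set where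
  apex    : PunchView z z
  punched : ∀ j → PunchView z (punchIn z j)

punchView : ∀ {a} (z v : Fin (suc a)) → PunchView z v
punchView z v with z Fin.≟ v
... | yes refl = apex
... | no z≢v   = subst (PunchView z) (punchIn-punchOut z≢v) (punched (punchOut z≢v))

record ApexBranchSet {a n} (A : Graph (suc a)) (z : Fin (suc a)) {G : Graph n}
                     (M : IsMinor (delete A z) G) (Z : Fin n → Set) : Set where
  open IsMinor M
  field
    inhabited : ∃ Z
    connected : ∀ {u v} → Z u → Z v → ConnIn G Z u v
    disjoint  : ∀ j {u} → Z u → ¬ branch j u
    touches   : ∀ j → A z (punchIn z j) ≡ true → ∃₂ λ s t → Z s × branch j t × G s t ≡ true

module _ {a n} {A : Graph (suc a)} {z : Fin (suc a)} {G : Graph n} where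

  IsMinor-addApex : Simple A → Symmetric G → (M : IsMinor (delete A z) G) →
                    ∀ {Z} → ApexBranchSet A z M Z → IsMinor A G
  IsMinor-addApex (sym-A , loopless-A) sym-G M {Z} ZM = record
    { branch    = λ v → branchOf (punchView z v)
    ; nonempty  = λ v → nonempty (punchView z v)
    ; connected = λ v u u' → connected (punchView z v)
    ; disjoint  = λ v w u → disjoint (punchView z v) (punchView z w)
    ; edges     = λ v w → edges (punchView z v) (punchView z w)
    }
    where
    module M = IsMinor M
    module Z = ApexBranchSet ZM

    branchOf : ∀ {v} → PunchView z v → Fin n → Set
    branchOf apex        = Z
    branchOf (punched j) = M.branch j

    nonempty : ∀ {v} (pv : PunchView z v) → ∃ (branchOf pv)
    nonempty apex        = Z.inhabited
    nonempty (punched j) = M.nonempty j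

    connected : ∀ {v u u'} (pv : PunchView z v) → branchOf pv u → branchOf pv u' →
                ConnIn G (branchOf pv) u u'
    connected apex        = Z.connected
    connected (punched j) = M.connected j _ _

    disjoint : ∀ {v w u} (pv : PunchView z v) (pw : PunchView z w) →
               branchOf pv u → branchOf pw u → v ≡ w
    disjoint apex        apex         _  _  = refl
    disjoint apex        (punched j)  zu bu = ⊥-elim (Z.disjoint j zu bu)
    disjoint (punched j) apex         bu zu = ⊥-elim (Z.disjoint j zu bu)
    disjoint (punched j) (punched j') bu bu' = cong (punchIn z) (M.disjoint j j' _ bu bu')

    edges : ∀ {v w} (pv : PunchView z v) (pw : PunchView z w) → A v w ≡ true →
            ∃₂ λ u u' → branchOf pv u × branchOf pw u' × G u u' ≡ true
    edges apex apex e with () ← trans (sym e) (loopless-A z)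
    edges apex (punched j) e = Z.touches j e
    edges (punched j) apex e with Z.touches j (trans (sym-A z _) e)
    ... | s , t , zs , bt , g = t , s , bt , zs , trans (sym-G t s) g
    edges (punched j) (punched j') e = M.edges j j' e

_∈[_,_] : ℕ → ℕ → ℕ → Set
x ∈[ lo , hi ] = lo ≤ x × x ≤ hi

∣n-1+n∣≡1 : ∀ n → ∣ n - suc n ∣ ≡ 1
∣n-1+n∣≡1 zero    = refl
∣n-1+n∣≡1 (suc n) = ∣n-1+n∣≡1 n

m+n≡1-cases : ∀ m n → m + n ≡ 1 → (m ≡ 0 × n ≡ 1) ⊎ (m ≡ 1 × n ≡ 0)
m+n≡1-cases zero          n    e  = inj₁ (refl , e)
m+n≡1-cases (suc zero)    zero _  = inj₂ (refl , refl)
m+n≡1-cases (suc zero)    (suc n) ()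
m+n≡1-cases (suc (suc m)) n    ()

∣m-n∣≡1-cases : ∀ m n → ∣ m - n ∣ ≡ 1 → suc m ≡ n ⊎ suc n ≡ m
∣m-n∣≡1-cases zero          (suc zero)    _ = inj₁ refl
∣m-n∣≡1-cases (suc zero)    zero          _ = inj₂ refl
∣m-n∣≡1-cases (suc m)       (suc n)       e with ∣m-n∣≡1-cases m n e
... | inj₁ e′ = inj₁ (cong suc e′)
... | inj₂ e′ = inj₂ (cong suc e′)
∣m-n∣≡1-cases zero          zero          ()
∣m-n∣≡1-cases zero          (suc (suc n)) ()
∣m-n∣≡1-cases (suc (suc m)) zero          ()

module GridCoordinates (K L : ℕ) where

  xcoord ycoord : Fin (K * L) → ℕ
  xcoord p = toℕ (proj₁ (remQuot {K} L p))
  ycoord p = toℕ (proj₂ (remQuot {K} L p))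

  xcoord<K : ∀ p → xcoord p < K
  xcoord<K p = toℕ<n _

  ycoord<L : ∀ p → ycoord p < L
  ycoord<L p = toℕ<n _

  point : ∀ {x y} → x < K → y < L → Fin (K * L)
  point x<K y<L = combine (fromℕ< x<K) (fromℕ< y<L)

  xcoord-point : ∀ {x y} (x<K : x < K) (y<L : y < L) → xcoord (point x<K y<L) ≡ x
  xcoord-point x<K y<L =
    trans (cong (λ c → toℕ (proj₁ c)) (remQuot-combine (fromℕ< x<K) (fromℕ< y<L))) (toℕ-fromℕ< x<K)

  ycoord-point : ∀ {x y} (x<K : x < K) (y<L : y < L) → ycoord (point x<K y<L) ≡ y
  ycoord-point x<K y<L =
    trans (cong (λ c → toℕ (proj₂ c)) (remQuot-combine (fromℕ< x<K) (fromℕ< y<L))) (toℕ-fromℕ< y<L)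

  coords-injective : ∀ {p q} → xcoord p ≡ xcoord q → ycoord p ≡ ycoord q → p ≡ q
  coords-injective {p} {q} ex ey =
    trans (sym (combine-remQuot {K} L p))
          (trans (cong₂ combine (toℕ-injective ex) (toℕ-injective ey)) (combine-remQuot {K} L q))

  grid-symmetric : Symmetric (grid K L)
  grid-symmetric p q =
    cong (_≡ᵇ 1) (cong₂ _+_ (∣-∣-comm (xcoord p) (xcoord q)) (∣-∣-comm (ycoord p) (ycoord q)))

  data Step (p q : Fin (K * L)) : Set where
    stepˣ : suc (xcoord p) ≡ xcoord q → ycoord p ≡ ycoord q → Step p q
    stepʸ : xcoord p ≡ xcoord q → suc (ycoord p) ≡ ycoord q → Step p q

  step-adjacent : ∀ {p q} → Step p q → grid K L p q ≡ true
  step-adjacent {p} {q} s = subst (λ d → (d ≡ᵇ 1) ≡ true) (sym (distance s)) refl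
    where
    distance : Step p q → ∣ xcoord p - xcoord q ∣ + ∣ ycoord p - ycoord q ∣ ≡ 1
    distance (stepˣ ex ey) rewrite sym ex | ey =
      cong₂ _+_ (∣n-1+n∣≡1 (xcoord p)) (∣n-n∣≡0 (ycoord q))
    distance (stepʸ ex ey) rewrite ex | sym ey =
      cong₂ _+_ (∣n-n∣≡0 (xcoord q)) (∣n-1+n∣≡1 (ycoord p))

  adjacent-step : ∀ {p q} → grid K L p q ≡ true → Step p q ⊎ Step q p
  adjacent-step {p} {q} e with m+n≡1-cases _ _ (≡ᵇ⇒≡ _ 1 (subst T (sym e) tt))
  ... | inj₁ (dx , dy) with ∣m-n∣≡1-cases _ _ dy
  ...   | inj₁ ey = inj₁ (stepʸ (∣m-n∣≡0⇒m≡n dx) ey)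
  ...   | inj₂ ey = inj₂ (stepʸ (sym (∣m-n∣≡0⇒m≡n dx)) ey)
  adjacent-step e | inj₂ (dx , dy) with ∣m-n∣≡1-cases _ _ dx
  ...   | inj₁ ex = inj₁ (stepˣ ex (∣m-n∣≡0⇒m≡n dy))
  ...   | inj₂ ex = inj₂ (stepˣ ex (sym (∣m-n∣≡0⇒m≡n dy)))

  OnRow : ℕ → ℕ → ℕ → Fin (K * L) → Set
  OnRow x lo hi v = xcoord v ≡ x × ycoord v ∈[ lo , hi ]

  OnColumn : ℕ → ℕ → ℕ → Fin (K * L) → Set
  OnColumn y lo hi v = ycoord v ≡ y × xcoord v ∈[ lo , hi ]

  private
    ConnIn-rightward : ∀ {S : Fin (K * L) → Set} {x lo hi} → OnRow x lo hi ⊆ S → ∀ t {p q} →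
                       OnRow x lo hi p → OnRow x lo hi q → ycoord p + t ≡ ycoord q →
                       ConnIn (grid K L) S p q
    ConnIn-rightward row⊆S zero (xp , _) (xq , _) e =
      subst (ConnIn _ _ _) (coords-injective (trans xp (sym xq)) (trans (sym (+-identityʳ _)) e)) here
    ConnIn-rightward row⊆S (suc t) {p} {q} (xp , lo≤p , _) q∈row@(_ , _ , q≤hi) e =
      step (step-adjacent (stepʸ (sym x′) (sym y′))) (row⊆S p′∈row)
           (ConnIn-rightward row⊆S t p′∈row q∈row (trans (cong (_+ t) y′) (trans (sym (+-suc _ t)) e)))
      where
      1+p≤q : suc (ycoord p) ≤ ycoord q
      1+p≤q = ≤-trans (m≤m+n (suc (ycoord p)) t) (≤-reflexive (trans (sym (+-suc _ t)) e))
      1+p<L : suc (ycoord p) < L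
      1+p<L = ≤-<-trans 1+p≤q (ycoord<L q)
      p′ : Fin (K * L)
      p′ = point (xcoord<K p) 1+p<L
      x′ : xcoord p′ ≡ xcoord p
      x′ = xcoord-point (xcoord<K p) 1+p<L
      y′ : ycoord p′ ≡ suc (ycoord p)
      y′ = ycoord-point (xcoord<K p) 1+p<L
      p′∈row : OnRow _ _ _ p′
      p′∈row = trans x′ xp , ≤-trans (≤-trans lo≤p (n≤1+n _)) (≤-reflexive (sym y′)) ,
               ≤-trans (≤-reflexive y′) (≤-trans 1+p≤q q≤hi)

  ConnIn-row : ∀ {S : Fin (K * L) → Set} {x lo hi p q} → OnRow x lo hi ⊆ S →
               OnRow x lo hi p → OnRow x lo hi q → ConnIn (grid K L) S p q
  ConnIn-row {p = p} {q} row⊆S p∈row q∈row with ≤-total (ycoord p) (ycoord q)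
  ... | inj₁ p≤q = ConnIn-rightward row⊆S _ p∈row q∈row (m+[n∸m]≡n p≤q)
  ... | inj₂ q≤p = ConnIn-sym grid-symmetric (row⊆S q∈row)
                     (ConnIn-rightward row⊆S _ q∈row p∈row (m+[n∸m]≡n q≤p))

  private
    ConnIn-downward : ∀ {S : Fin (K * L) → Set} {y lo hi} → OnColumn y lo hi ⊆ S → ∀ t {p q} →
                      OnColumn y lo hi p → OnColumn y lo hi q → xcoord p + t ≡ xcoord q →
                      ConnIn (grid K L) S p q
    ConnIn-downward col⊆S zero (yp , _) (yq , _) e =
      subst (ConnIn _ _ _) (coords-injective (trans (sym (+-identityʳ _)) e) (trans yp (sym yq))) here
    ConnIn-downward col⊆S (suc t) {p} {q} (yp , lo≤p , _) q∈col@(_ , _ , q≤hi) e =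
      step (step-adjacent (stepˣ (sym x′) (sym y′))) (col⊆S p′∈col)
           (ConnIn-downward col⊆S t p′∈col q∈col (trans (cong (_+ t) x′) (trans (sym (+-suc _ t)) e)))
      where
      1+p≤q : suc (xcoord p) ≤ xcoord q
      1+p≤q = ≤-trans (m≤m+n (suc (xcoord p)) t) (≤-reflexive (trans (sym (+-suc _ t)) e))
      1+p<K : suc (xcoord p) < K
      1+p<K = ≤-<-trans 1+p≤q (xcoord<K q)
      p′ : Fin (K * L)
      p′ = point 1+p<K (ycoord<L p)
      x′ : xcoord p′ ≡ suc (xcoord p)
      x′ = xcoord-point 1+p<K (ycoord<L p)
      y′ : ycoord p′ ≡ ycoord p
      y′ = ycoord-point 1+p<K (ycoord<L p)
      p′∈col : OnColumn _ _ _ p′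
      p′∈col = trans y′ yp , ≤-trans (≤-trans lo≤p (n≤1+n _)) (≤-reflexive (sym x′)) ,
               ≤-trans (≤-reflexive x′) (≤-trans 1+p≤q q≤hi)

  ConnIn-column : ∀ {S : Fin (K * L) → Set} {y lo hi p q} → OnColumn y lo hi ⊆ S →
                  OnColumn y lo hi p → OnColumn y lo hi q → ConnIn (grid K L) S p q
  ConnIn-column {p = p} {q} col⊆S p∈col q∈col with ≤-total (xcoord p) (xcoord q)
  ... | inj₁ p≤q = ConnIn-downward col⊆S _ p∈col q∈col (m+[n∸m]≡n p≤q)
  ... | inj₂ q≤p = ConnIn-sym grid-symmetric (col⊆S q∈col)
                     (ConnIn-downward col⊆S _ q∈col p∈col (m+[n∸m]≡n q≤p))

∃∉-window : ∀ (xs : List ℕ) base m → length xs < m → ∃ λ t → t < m × base + t ∉ xs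
∃∉-window xs base m |xs|<m
  with ¬∀⟶∃¬ m (λ t → base + toℕ t ∈ xs) (λ t → base + toℕ t ∈? xs) ¬all
  where
  open import Data.List.Membership.DecPropositional _≟_ using (_∈?_)
  ¬all : ¬ (∀ t → base + toℕ t ∈ xs)
  ¬all all with pigeonhole |xs|<m (λ t → index (all t))
  ... | s , t , s<t , same = <⇒≢ s<t (+-cancelˡ-≡ base _ _
          (trans (lookup-index (all s)) (trans (cong (lookup xs) same) (sym (lookup-index (all t))))))
... | t , t∉ = toℕ t , toℕ<n t , t∉

module Blocks (k ℓ K L w₀ : ℕ) (wk≤K : suc w₀ * k ≤ K) (wℓ≤L : suc w₀ * ℓ ≤ L) where
  open GridCoordinates K L
  module Cell = GridCoordinates k ℓ

  w : ℕ
  w = suc w₀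

  Band : ℕ → ℕ → Set
  Band i x = x ∈[ w * i , w * i + w₀ ]

  band-start : ∀ i → Band i (w * i)
  band-start i = ≤-refl , m≤m+n _ _

  band-end : ∀ i → Band i (w * i + w₀)
  band-end i = m≤m+n _ _ , ≤-refl

  band-next : ∀ i → suc (w * i + w₀) ≡ w * suc i
  band-next i = trans (sym (+-suc (w * i) w₀)) (trans (+-comm (w * i) w) (sym (*-suc w i)))

  band-below : ∀ {i j x} → i < j → Band i x → x < w * j
  band-below {i} {j} i<j (_ , x≤end) =
    <-≤-trans (s≤s x≤end) (subst (_≤ w * j) (sym (band-next i)) (*-monoʳ-≤ w i<j))

  band-unique : ∀ {i j x} → Band i x → Band j x → i ≡ j
  band-unique {i} {j} x∈i x∈j with <-cmp i j
  ... | tri< i<j _ _ = contradiction (proj₁ x∈j) (<⇒≱ (band-below i<j x∈i))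
  ... | tri≈ _ i≡j _ = i≡j
  ... | tri> _ _ j<i = contradiction (proj₁ x∈i) (<⇒≱ (band-below j<i x∈j))

  band<K : ∀ {i x} → i < k → Band i x → x < K
  band<K i<k x∈i = <-≤-trans (band-below i<k x∈i) wk≤K

  band<L : ∀ {j y} → j < ℓ → Band j y → y < L
  band<L j<ℓ y∈j = <-≤-trans (band-below j<ℓ y∈j) wℓ≤L

  module _ (c : Fin (k * ℓ)) where

    blockPoint : ∀ {x y} → Band (Cell.xcoord c) x → Band (Cell.ycoord c) y → Fin (K * L)
    blockPoint x∈ y∈ = point (band<K (Cell.xcoord<K c) x∈) (band<L (Cell.ycoord<L c) y∈)

    blockPoint-x : ∀ {x y} (x∈ : Band (Cell.xcoord c) x) (y∈ : Band (Cell.ycoord c) y) →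
                   xcoord (blockPoint x∈ y∈) ≡ x
    blockPoint-x x∈ y∈ = xcoord-point (band<K (Cell.xcoord<K c) x∈) (band<L (Cell.ycoord<L c) y∈)

    blockPoint-y : ∀ {x y} (x∈ : Band (Cell.xcoord c) x) (y∈ : Band (Cell.ycoord c) y) →
                   ycoord (blockPoint x∈ y∈) ≡ y
    blockPoint-y x∈ y∈ = ycoord-point (band<K (Cell.xcoord<K c) x∈) (band<L (Cell.ycoord<L c) y∈)

    -- Independent of the avoided set X, since the walks that determine X end at corners.
    corner : Fin (K * L)
    corner = blockPoint (band-start _) (band-start _)

  module Avoiding (X : List (Fin (K * L))) (X-short : length X < w) where
    open import Data.List.Membership.DecPropositional (Fin._≟_ {K * L}) using (_∈?_)

    private
      window : (f : Fin (K * L) → ℕ) (i : ℕ) → ∃ λ t → t < w × w * i + t ∉ map f X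
      window f i = ∃∉-window (map f X) (w * i) w (subst (_< w) (sym (length-map f X)) X-short)

    free : (Fin (K * L) → ℕ) → ℕ → ℕ
    free f i = w * i + proj₁ (window f i)

    free-band : ∀ f i → Band i (free f i)
    free-band f i = m≤m+n _ _ , +-monoʳ-≤ (w * i) (≤-pred (proj₁ (proj₂ (window f i))))

    free-∉ : ∀ f i → free f i ∉ map f X
    free-∉ f i = proj₂ (proj₂ (window f i))

    freeRow freeColumn : ℕ → ℕ
    freeRow    = free xcoord
    freeColumn = free ycoord

    SpurFree : ℕ → ℕ → ℕ → Set
    SpurFree i j x = ∀ {v} → OnColumn (w * j) x (freeRow i) v → v ∉ X

    -- The spur makes each branch set contain the corner of its block or end next to a point of X.
    data InBlock (i j : ℕ) (v : Fin (K * L)) : Set where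
      row    : OnRow (freeRow i) (w * j) (w * j + w₀) v → InBlock i j v
      column : OnColumn (freeColumn j) (w * i) (w * i + w₀) v → InBlock i j v
      spur   : ∀ {x} → w * i ≤ x → SpurFree i j x → OnColumn (w * j) x (freeRow i) v →
               InBlock i j v

    InBlock-band : ∀ {i j v} → InBlock i j v → Band i (xcoord v) × Band j (ycoord v)
    InBlock-band {i} {j} (row (x≡ , y∈))    = subst (Band i) (sym x≡) (free-band xcoord i) , y∈
    InBlock-band {i} {j} (column (y≡ , x∈)) = x∈ , subst (Band j) (sym y≡) (free-band ycoord j)
    InBlock-band {i} {j} (spur wi≤x _ (y≡ , x≤v , v≤ρ)) =
      (≤-trans wi≤x x≤v , ≤-trans v≤ρ (proj₂ (free-band xcoord i))) ,
      subst (Band j) (sym y≡) (band-start j)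

    InBlock-∉ : ∀ {i j v} → InBlock i j v → v ∉ X
    InBlock-∉ {i} (row (x≡ , _)) v∈X =
      free-∉ xcoord i (subst (_∈ map xcoord X) x≡ (∈-map⁺ xcoord v∈X))
    InBlock-∉ {j = j} (column (y≡ , _)) v∈X =
      free-∉ ycoord j (subst (_∈ map ycoord X) y≡ (∈-map⁺ ycoord v∈X))
    InBlock-∉ (spur _ spur-free v∈spur) = spur-free v∈spur

    branch : Fin (k * ℓ) → Fin (K * L) → Set
    branch c = InBlock (Cell.xcoord c) (Cell.ycoord c)

    module _ (c : Fin (k * ℓ)) where
      private
        i j : ℕ
        i = Cell.xcoord c
        j = Cell.ycoord c
        ρ∈ : Band i (freeRow i)
        ρ∈ = free-band xcoord i
        γ∈ : Band j (freeColumn j)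
        γ∈ = free-band ycoord j

      onRow : ∀ {y} (y∈ : Band j y) → OnRow (freeRow i) (w * j) (w * j + w₀) (blockPoint c ρ∈ y∈)
      onRow y∈ = blockPoint-x c ρ∈ y∈ , subst (Band j) (sym (blockPoint-y c ρ∈ y∈)) y∈

      onColumn : ∀ {x} (x∈ : Band i x) →
                 OnColumn (freeColumn j) (w * i) (w * i + w₀) (blockPoint c x∈ γ∈)
      onColumn x∈ = blockPoint-y c x∈ γ∈ , subst (Band i) (sym (blockPoint-x c x∈ γ∈)) x∈

      centre : Fin (K * L)
      centre = blockPoint c ρ∈ γ∈

      centre∈ : InBlock i j centre
      centre∈ = row (onRow γ∈)

      ConnIn-centre : ∀ {v} → InBlock i j v → ConnIn (grid K L) (InBlock i j) centre v
      ConnIn-centre (row v∈row)    = ConnIn-row row (onRow γ∈) v∈row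
      ConnIn-centre (column v∈col) = ConnIn-column column (onColumn ρ∈) v∈col
      ConnIn-centre (spur {x} wi≤x spur-free v∈spur@(_ , x≤v , v≤ρ)) =
        ConnIn-trans (ConnIn-row row (onRow γ∈) (onRow (band-start j)))
                     (ConnIn-column (spur wi≤x spur-free) hub-onSpur v∈spur)
        where
        hub-onSpur : OnColumn (w * j) x (freeRow i) (blockPoint c ρ∈ (band-start j))
        hub-onSpur = blockPoint-y c ρ∈ (band-start j) ,
                     subst (x ≤_) (sym (blockPoint-x c ρ∈ (band-start j))) (≤-trans x≤v v≤ρ) ,
                     ≤-reflexive (blockPoint-x c ρ∈ (band-start j))

      InBlock-connected : ∀ {u v} → InBlock i j u → InBlock i j v → ConnIn (grid K L) (InBlock i j) u v
      InBlock-connected u∈ v∈ =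
        ConnIn-trans (ConnIn-sym grid-symmetric centre∈ (ConnIn-centre u∈)) (ConnIn-centre v∈)

      Attached : Set
      Attached = InBlock i j (corner c) ⊎ ∃₂ λ v x → InBlock i j v × x ∈ X × grid K L v x ≡ true

      private
        spurPoint : ∀ s → w * i + s ≤ freeRow i → Fin (K * L)
        spurPoint s le = blockPoint c (m≤m+n _ _ , ≤-trans le (proj₂ ρ∈)) (band-start j)

        spurPoint-x : ∀ s le → xcoord (spurPoint s le) ≡ w * i + s
        spurPoint-x s le = blockPoint-x c (m≤m+n _ _ , ≤-trans le (proj₂ ρ∈)) (band-start j)

        spurPoint-y : ∀ s le → ycoord (spurPoint s le) ≡ w * j
        spurPoint-y s le = blockPoint-y c (m≤m+n _ _ , ≤-trans le (proj₂ ρ∈)) (band-start j)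

      attached-from : ∀ s → w * i + s ≤ freeRow i → SpurFree i j (w * i + s) → Attached
      attached-from zero _ spur-free = inj₁ (spur (m≤m+n _ _) spur-free
        ( blockPoint-y c (band-start i) (band-start j)
        , ≤-reflexive (trans (+-identityʳ _) (sym (blockPoint-x c (band-start i) (band-start j))))
        , subst (_≤ freeRow i) (sym (blockPoint-x c (band-start i) (band-start j))) (proj₁ ρ∈) ))
      attached-from (suc s) le spur-free = stepBack (q ∈? X)
        where
        le′ : w * i + s ≤ freeRow i
        le′ = ≤-trans (+-monoʳ-≤ (w * i) (n≤1+n s)) le
        q v : Fin (K * L)
        q = spurPoint s le′
        v = spurPoint (suc s) le

        v∈spur : OnColumn (w * j) (w * i + suc s) (freeRow i) v
        v∈spur = spurPoint-y (suc s) le , ≤-reflexive (sym (spurPoint-x (suc s) le)) ,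
                 subst (_≤ freeRow i) (sym (spurPoint-x (suc s) le)) le

        q→v : Step q v
        q→v = stepˣ (trans (cong suc (spurPoint-x s le′))
                           (trans (sym (+-suc _ s)) (sym (spurPoint-x (suc s) le))))
                    (trans (spurPoint-y s le′) (sym (spurPoint-y (suc s) le)))

        extended : q ∉ X → SpurFree i j (w * i + s)
        extended q∉X {u} (yu , s≤u , u≤ρ) with m≤n⇒m<n∨m≡n s≤u
        ... | inj₁ s<u = spur-free (yu , subst (_≤ xcoord u) (sym (+-suc (w * i) s)) s<u , u≤ρ)
        ... | inj₂ s≡u = subst (_∉ X) (coords-injective (trans (spurPoint-x s le′) s≡u)
                                                        (trans (spurPoint-y s le′) (sym yu))) q∉X

        stepBack : Dec (q ∈ X) → Attached
        stepBack (yes q∈X) = inj₂ (v , q , spur (m≤m+n _ _) spur-free v∈spur , q∈X ,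
                                   trans (grid-symmetric v q) (step-adjacent q→v))
        stepBack (no q∉X)  = attached-from s le′ (extended q∉X)

      attached : Attached
      attached = attached-from (freeRow i ∸ w * i) (≤-reflexive (m+[n∸m]≡n (proj₁ ρ∈))) top-free
        where
        top-free : SpurFree i j (w * i + (freeRow i ∸ w * i))
        top-free {v} (_ , ρ≤v , v≤ρ) v∈X = free-∉ xcoord i
          (subst (_∈ map xcoord X) (≤-antisym v≤ρ (subst (_≤ xcoord v) (m+[n∸m]≡n (proj₁ ρ∈)) ρ≤v))
                 (∈-map⁺ xcoord v∈X))

    block-edge : ∀ {c c'} → Cell.Step c c' →
                 ∃₂ λ p p' → branch c p × branch c' p' × grid K L p p' ≡ true
    block-edge {c} {c'} (Cell.stepʸ ex ey) =
      _ , _ , row (onRow c (band-end j)) , row (onRow c' (band-start j')) , step-adjacent (stepʸ x≡ y≡)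
      where
      i j j' : ℕ
      i = Cell.xcoord c ; j = Cell.ycoord c ; j' = Cell.ycoord c'
      x≡ : xcoord (blockPoint c (free-band xcoord i) (band-end j)) ≡
           xcoord (blockPoint c' (free-band xcoord (Cell.xcoord c')) (band-start j'))
      x≡ = trans (proj₁ (onRow c (band-end j)))
                 (trans (cong freeRow ex) (sym (proj₁ (onRow c' (band-start j')))))
      y≡ : suc (ycoord (blockPoint c (free-band xcoord i) (band-end j))) ≡
           ycoord (blockPoint c' (free-band xcoord (Cell.xcoord c')) (band-start j'))
      y≡ = trans (cong suc (blockPoint-y c (free-band xcoord i) (band-end j)))
                 (trans (band-next j) (trans (cong (w *_) ey)
                        (sym (blockPoint-y c' (free-band xcoord (Cell.xcoord c')) (band-start j')))))
    block-edge {c} {c'} (Cell.stepˣ ex ey) =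
      _ , _ , column (onColumn c (band-end i)) , column (onColumn c' (band-start i')) ,
      step-adjacent (stepˣ x≡ y≡)
      where
      i j i' : ℕ
      i = Cell.xcoord c ; j = Cell.ycoord c ; i' = Cell.xcoord c'
      y≡ : ycoord (blockPoint c (band-end i) (free-band ycoord j)) ≡
           ycoord (blockPoint c' (band-start i') (free-band ycoord (Cell.ycoord c')))
      y≡ = trans (proj₁ (onColumn c (band-end i)))
                 (trans (cong freeColumn ey) (sym (proj₁ (onColumn c' (band-start i')))))
      x≡ : suc (xcoord (blockPoint c (band-end i) (free-band ycoord j))) ≡
           xcoord (blockPoint c' (band-start i') (free-band ycoord (Cell.ycoord c')))
      x≡ = trans (cong suc (blockPoint-x c (band-end i) (free-band ycoord j)))
                 (trans (band-next i) (trans (cong (w *_) ex)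
                        (sym (blockPoint-x c' (band-start i') (free-band ycoord (Cell.ycoord c'))))))

    model : IsMinor (grid k ℓ) (grid K L)
    model = record
      { branch    = branch
      ; nonempty  = λ c → centre c , centre∈ c
      ; connected = λ c u v → InBlock-connected c
      ; disjoint  = λ c c' v v∈c v∈c' →
          Cell.coords-injective (band-unique (proj₁ (InBlock-band v∈c)) (proj₁ (InBlock-band v∈c')))
                                (band-unique (proj₂ (InBlock-band v∈c)) (proj₂ (InBlock-band v∈c')))
      ; edges     = λ c c' e → edges (Cell.adjacent-step e)
      }
      where
      edges : ∀ {c c'} → Cell.Step c c' ⊎ Cell.Step c' c →
              ∃₂ λ p p' → branch c p × branch c' p' × grid K L p p' ≡ true
      edges (inj₁ c→c') = block-edge c→c'
      edges (inj₂ c'→c) with block-edge c'→c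
      ... | p' , p , p'∈ , p∈ , e = p , p' , p∈ , p'∈ , trans (grid-symmetric p p') e

length-concat-tabulate : ∀ {A : Set} {a} (f : Fin a → List A) (g : Fin a → ℕ) c →
                         (∀ j → length (f j) ≤ c * g j) →
                         length (concat (tabulate f)) ≤ c * sum (tabulate g)
length-concat-tabulate {a = zero}  f g c f≤cg = z≤n
length-concat-tabulate {a = suc a} f g c f≤cg = begin
  length (f zero ++ concat (tabulate (f ∘ suc)))         ≡⟨ length-++ (f zero) ⟩
  length (f zero) + length (concat (tabulate (f ∘ suc))) ≤⟨ +-mono-≤ (f≤cg zero) rest ⟩
  c * g zero + c * sum (tabulate (g ∘ suc))              ≡⟨ *-distribˡ-+ c _ _ ⟨
  c * sum (tabulate g)                                   ∎
  where
  open ≤-Reasoning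
  rest : length (concat (tabulate (f ∘ suc))) ≤ c * sum (tabulate (g ∘ suc))
  rest = length-concat-tabulate (f ∘ suc) (g ∘ suc) c (f≤cg ∘ suc)

sum-tabulate-punchIn : ∀ {a} (z : Fin (suc a)) (f : Fin (suc a) → ℕ) → f z ≡ 0 →
                       sum (tabulate (f ∘ punchIn z)) ≡ sum (tabulate f)
sum-tabulate-punchIn zero            f fz≡0 = cong (_+ sum (tabulate (f ∘ suc))) (sym fz≡0)
sum-tabulate-punchIn {suc a} (suc z) f fz≡0 =
  cong (f zero +_) (sum-tabulate-punchIn z (f ∘ suc) fz≡0)

degree-punchIn : ∀ {a} (A : Graph (suc a)) z → A z z ≡ false →
                 degree A z ≡ sum (tabulate (λ j → if A z (punchIn z j) then 1 else 0))
degree-punchIn A z loopless =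
  trans (cong sum (map-tabulate (λ v → v) indicator))
        (sym (sum-tabulate-punchIn z indicator (cong (λ b → if b then 1 else 0) loopless)))
  where
  indicator : _ → ℕ
  indicator v = if A z v then 1 else 0

length-if : ∀ {A : Set} b (xs : List A) c → length xs ≤ c →
            length (if b then xs else []) ≤ c * (if b then 1 else 0)
length-if true  xs c ≤c = subst (length xs ≤_) (sym (*-identityʳ c)) ≤c
length-if false xs c ≤c = z≤n

¬¬-decidable : ∀ {n} (P : Fin n → Set) → ¬ ¬ (∀ v → Dec (P v))
¬¬-decidable {zero}  P ¬dec = ¬dec (λ ())
¬¬-decidable {suc n} P ¬dec = ¬¬-excluded-middle λ dec₀ →
  ¬¬-decidable (P ∘ suc) λ dec₊ → ¬dec λ { zero → dec₀ ; (suc v) → dec₊ v }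

module ApexMinor {a} (A : Graph (suc a)) (z : Fin (suc a)) (simple-A : Simple A)
                 {k ℓ} (H⊑grid : IsMinor (delete A z) (grid k ℓ))
                 {N} {G : Graph N} (sym-G : Symmetric G) {r} (α : Fin N)
                 (walk-from-α : ∀ v → ∃ λ m → m ≤ r × Walk G α v m)
                 {K L w₀} (wk≤K : suc w₀ * k ≤ K) (wℓ≤L : suc w₀ * ℓ ≤ L)
                 (w-large : suc ((r ∸ 1) * degree A z) < suc w₀)
                 (grid⊑G : IsMinor (grid K L) G)
                 (owned? : ∀ v → Dec (∃ λ p → IsMinor.branch grid⊑G p v)) where

  open Blocks k ℓ K L w₀ wk≤K wℓ≤L
  open Owners grid⊑G owned?
  module H = IsMinor H⊑grid
  module Γ = IsMinor grid⊑G

  anchorCell : Fin a → Fin (k * ℓ)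
  anchorCell j = proj₁ (H.nonempty j)

  anchor : Fin a → Fin N
  anchor j = proj₁ (Γ.nonempty (corner (anchorCell j)))

  route : ∀ j → Walk G α (anchor j) (proj₁ (walk-from-α (anchor j)))
  route j = proj₂ (proj₂ (walk-from-α (anchor j)))

  detour : Fin a → List (Fin N)
  detour j = if A z (punchIn z j) then interior (route j) else []

  Z₀ : List (Fin N)
  Z₀ = α ∷ concat (tabulate detour)

  length-Z₀ : length Z₀ ≤ suc ((r ∸ 1) * degree A z)
  length-Z₀ = s≤s (subst (λ d → length (concat (tabulate detour)) ≤ (r ∸ 1) * d)
                         (sym (degree-punchIn A z (proj₂ simple-A z)))
                         (length-concat-tabulate detour _ (r ∸ 1) length-detour))
    where
    length-detour : ∀ j → length (detour j) ≤ (r ∸ 1) * (if A z (punchIn z j) then 1 else 0)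
    length-detour j = length-if (A z (punchIn z j)) (interior (route j)) (r ∸ 1)
      (subst (_≤ r ∸ 1) (sym (length-interior (route j)))
             (∸-monoˡ-≤ 1 (proj₁ (proj₂ (walk-from-α (anchor j))))))

  interior⊆Z₀ : ∀ j → A z (punchIn z j) ≡ true → ∀ {v} → v ∈ interior (route j) → v ∈ Z₀
  interior⊆Z₀ j adj {v} v∈ =
    there (∈-concat⁺′ (subst (λ b → v ∈ (if b then interior (route j) else [])) (sym adj) v∈)
                      (∈-tabulate⁺ j))

  ConnIn-Z₀ : ∀ {u} → u ∈ Z₀ → ConnIn G (_∈ Z₀) α u
  ConnIn-Z₀ (here refl) = here
  ConnIn-Z₀ (there u∈) with ∈-concat⁻′ (tabulate detour) u∈
  ... | xs , u∈xs , xs∈ with ∈-tabulate⁻ xs∈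
  ... | j , refl = from-detour (A z (punchIn z j)) refl u∈xs
    where
    from-detour : ∀ b → A z (punchIn z j) ≡ b → ∀ {u} → u ∈ (if b then interior (route j) else []) →
                  ConnIn G (_∈ Z₀) α u
    from-detour true adj u∈ = ConnIn-mono (interior⊆Z₀ j adj) (ConnIn-interior (route j) u∈)
    from-detour false _ ()

  X : List (Fin (K * L))
  X = owners Z₀

  open Avoiding X (≤-<-trans (≤-trans (length-owners Z₀) length-Z₀) w-large)

  H⊑G : IsMinor (delete A z) G
  H⊑G = IsMinor-trans (IsMinor-trans H⊑grid model) grid⊑G

  module H⊑G = IsMinor H⊑G

  Z : Fin N → Set
  Z u = u ∈ Z₀ ⊎ BranchUnion grid⊑G (_∈ X) u

  ConnIn-Z : ∀ {u} → Z u → ConnIn G Z α u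
  ConnIn-Z (inj₁ u∈) = ConnIn-mono inj₁ (ConnIn-Z₀ u∈)
  ConnIn-Z {u} (inj₂ (p , p∈X , pu)) with ∈-owners⁻ Z₀ p∈X
  ... | v , v∈ , pv = ConnIn-trans (ConnIn-mono inj₁ (ConnIn-Z₀ v∈))
                                   (ConnIn-mono (λ pw → inj₂ (p , p∈X , pw)) (Γ.connected p v u pv pu))

  Z-disjoint : ∀ j {u} → Z u → ¬ H⊑G.branch j u
  Z-disjoint j (inj₁ u∈) (p , (_ , _ , p∈c) , pu) = InBlock-∉ p∈c (∈-owners⁺ Z₀ u∈ pu)
  Z-disjoint j {u} (inj₂ (q , q∈X , qu)) (p , (_ , _ , p∈c) , pu) =
    InBlock-∉ p∈c (subst (_∈ X) (Γ.disjoint q p u qu pu) q∈X)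

  module _ (j : Fin a) where

    Touches : Set
    Touches = ∃₂ λ s t → Z s × H⊑G.branch j t × G s t ≡ true

    anchor∈ : branch (anchorCell j) (corner (anchorCell j)) → H⊑G.branch j (anchor j)
    anchor∈ corner∈ =
      corner (anchorCell j) , (anchorCell j , proj₂ (H.nonempty j) , corner∈) , proj₂ (Γ.nonempty _)

    reach : branch (anchorCell j) (corner (anchorCell j)) →
            ∀ {u m} (p : Walk G u (anchor j) m) → u ∈ Z₀ → (∀ {v} → v ∈ interior p → v ∈ Z₀) → Touches
    reach corner∈ nil u∈ _ = ⊥-elim (InBlock-∉ corner∈ (∈-owners⁺ Z₀ u∈ (proj₂ (Γ.nonempty _))))
    reach corner∈ {u} p@(cons _ _) u∈ interior⊆ =
      let s , s≡u⊎s∈ , g = last-edge p in s , anchor j , inj₁ (s∈Z₀ s≡u⊎s∈) , anchor∈ corner∈ , g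
      where
      s∈Z₀ : ∀ {s} → s ≡ u ⊎ s ∈ interior p → s ∈ Z₀
      s∈Z₀ (inj₁ refl) = u∈
      s∈Z₀ (inj₂ s∈)   = interior⊆ s∈

    Z-touches : A z (punchIn z j) ≡ true → Touches
    Z-touches adj = touching (attached (anchorCell j))
      where
      touching : Attached (anchorCell j) → Touches
      touching (inj₁ corner∈) = reach corner∈ (route j) (here refl) (interior⊆Z₀ j adj)
      touching (inj₂ (p , x , p∈ , x∈X , px)) =
        let u , u′ , pu , xu′ , uu′ = Γ.edges p x px
        in u′ , u , inj₂ (x , x∈X , xu′) , (p , (anchorCell j , proj₂ (H.nonempty j) , p∈) , pu) ,
           trans (sym-G u′ u) uu′

  apexBranchSet : ApexBranchSet A z H⊑G Z
  apexBranchSet = record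
    { inhabited = α , inj₁ (here refl)
    ; connected = λ zu zv →
        ConnIn-trans (ConnIn-sym sym-G (inj₁ (here refl)) (ConnIn-Z zu)) (ConnIn-Z zv)
    ; disjoint  = Z-disjoint
    ; touches   = Z-touches
    }

  apex-minor : IsMinor A G
  apex-minor = IsMinor-addApex simple-A sym-G H⊑G apexBranchSet

blocks-fit : ∀ e k → suc (2 * e + 1) * k ≡ 2 * k * (e + 1)
blocks-fit = solve-∀

double-bound : ∀ x y → 2 * (4 * x * y) + 1 ≡ suc (x * y + 7 * (x * y))
double-bound = solve-∀

lemma12 : ∀ {a} (A : Graph (suc a)) (z : Fin (suc a)) → Simple A →
    (k ℓ : ℕ) → 1 ≤ k → 1 ≤ ℓ → IsMinor (delete A z) (grid k ℓ) →
    (r : ℕ) → 1 ≤ r →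
    ∀ {N} (G : Graph N) → Simple G → ¬ IsMinor A G → Radius G r →
    ¬ IsMinor (grid (2 * k * (4 * (r ∸ 1) * degree A z + 1) + 1)
                    (2 * ℓ * (4 * (r ∸ 1) * degree A z + 1) + 1)) G
lemma12 A z simple-A k ℓ _ _ H⊑grid r _ G simple-G A⋢G ((α , walk-from-α) , _) grid⊑G =
  ¬¬-decidable (λ v → ∃ λ p → IsMinor.branch grid⊑G p v) λ owned? →
    A⋢G (ApexMinor.apex-minor A z simple-A H⊑grid (proj₁ simple-G) α walk-from-α
                              (fits k) (fits ℓ) large grid⊑G owned?)
  where
  -- Blocks have width 2 * e + 2 = 2n, but only 1 + (r ∸ 1) * d < 2n is used.
  e : ℕ
  e = 4 * (r ∸ 1) * degree A z

  fits : ∀ m → suc (2 * e + 1) * m ≤ 2 * m * (e + 1) + 1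
  fits m = subst (_≤ 2 * m * (e + 1) + 1) (sym (blocks-fit e m)) (m≤m+n _ 1)

  large : suc ((r ∸ 1) * degree A z) < suc (2 * e + 1)
  large = s≤s (subst (suc ((r ∸ 1) * degree A z) ≤_) (sym (double-bound (r ∸ 1) (degree A z)))
                     (s≤s (m≤m+n _ _)))
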